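{- Let $\ell$ be a prime and let $G\leqslant\mathrm{Sym}(\Omega)$ be a finite permutation group. If $S$ is an intersecting subgroup of $G$, then $S\wr\mathbb{Z}_\ell=S^{\mathbb{Z}_\ell}{:}\mathbb{Z}_\ell$ is an intersecting subgroup of $G\wr\mathbb{Z}_\ell\leqslant\mathrm{Sym}(\Omega^{\mathbb{Z}_\ell})$.
   Context: $\Omega^{\mathbb{Z}_\ell}$ is the set of functions $\pi:\mathbb{Z}_\ell\to\Omega$. The group $G^{\mathbb{Z}_\ell}$ of functions $f:\mathbb{Z}_\ell\to G$ acts by $(f\pi)(j)=f(j)\pi(j)$, and $m\in\mathbb{Z}_\ell$ acts by $(m\cdot\pi)(j)=\pi(j-m)$; $G\wr\mathbb{Z}_\ell=G^{\mathbb{Z}_\ell}{:}\mathbb{Z}_\ell$ is the resulting permutation group on $\Omega^{\mathbb{Z}_\ell}$, the element $(f;m)$ acting by $((f;m)\pi)(i)=f(i-m)\pi(i-m)$. For a subgroup $S\leqslant G$, $S\wr\mathbb{Z}_\ell$ is the subgroup $\{(f;m): f(j)\in S \text{ for all } j\}$. An intersecting subgroup of a permutation group $X\leqslant\mathrm{Sym}(\Lambda)$ is a subgroup $Y$ such that for all $x,y\in Y$ there exists $\lambda\in\Lambda$ fixed by $xy^{ -1}$. -}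

module Defs where

open import Data.Nat using (ℕ; _+_; _∸_; NonZero)
open import Data.Nat.DivMod using (_mod_)
open import Data.Fin using (Fin; toℕ)
open import Data.Fin.Permutation using (Permutation′; _⟨$⟩ʳ_; id; flip; _∘ₚ_)
open import Data.Product using (Σ; _×_)
open import Relation.Binary.PropositionalEquality using (_≡_)

-- conventional product: (x · y) ω = x (y ω)   (_∘ₚ_ is diagrammatic)
_·_ : ∀ {n} → Permutation′ n → Permutation′ n → Permutation′ n
x · y = y ∘ₚ x

_⁻¹ : ∀ {n} → Permutation′ n → Permutation′ n
x ⁻¹ = flip x

record IsPermGroup {n : ℕ} (G : Permutation′ n → Set) : Set where
  field
    id∈   : G id
    ·-closed : ∀ {x y} → G x → G y → G (x · y)
    ⁻¹-closed : ∀ {x} → G x → G (x ⁻¹)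

record IsSubgroup {n : ℕ} (S G : Permutation′ n → Set) : Set where
  field
    ⊆G : ∀ {x} → S x → G x
    isGroup : IsPermGroup S

Intersecting : ∀ {n} → (Permutation′ n → Set) → Set
Intersecting {n} S =
  ∀ x y → S x → S y → Σ (Fin n) λ ω → ((x · (y ⁻¹)) ⟨$⟩ʳ ω) ≡ ω

module Wreath (n ℓ : ℕ) .{{_ : NonZero ℓ}} where

  _⊕_ : Fin ℓ → Fin ℓ → Fin ℓ
  i ⊕ m = (toℕ i + toℕ m) mod ℓ

  _⊖_ : Fin ℓ → Fin ℓ → Fin ℓ
  i ⊖ m = (toℕ i + (ℓ ∸ toℕ m)) mod ℓ

  0ℓ : Fin ℓ
  0ℓ = 0 mod ℓ

  ⊝_ : Fin ℓ → Fin ℓ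
  ⊝ m = 0ℓ ⊖ m

  Point : Set
  Point = Fin ℓ → Fin n

  -- elements (f ; m) of Sym(Ω)^{ℤ_ℓ} : ℤ_ℓ
  record Elt : Set where
    constructor _︔_
    field
      fun   : Fin ℓ → Permutation′ n
      shift : Fin ℓ
  open Elt public

  act : Elt → Point → Point
  act (f ︔ m) π i = f (i ⊖ m) ⟨$⟩ʳ π (i ⊖ m)

  -- group operations of the wreath product (compatible with act)
  -- (f;m)(g;k) = (j ↦ f(j+k) g(j) ; m+k)
  _⋆_ : Elt → Elt → Elt
  (f ︔ m) ⋆ (g ︔ k) = (λ j → f (j ⊕ k) · g j) ︔ (m ⊕ k)

  inv : Elt → Elt
  inv (f ︔ m) = (λ j → f (j ⊖ m) ⁻¹) ︔ (⊝ m)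

  one : Elt
  one = (λ _ → id) ︔ 0ℓ

  _≀ℤ : (Permutation′ n → Set) → Elt → Set
  (X ≀ℤ) (f ︔ m) = ∀ j → X (f j)

  record IsWrSubgroup (Y X : Elt → Set) : Set where
    field
      ⊆X : ∀ {x} → Y x → X x
      one∈ : Y one
      ⋆-closed : ∀ {x y} → Y x → Y y → Y (x ⋆ y)
      inv-closed : ∀ {x} → Y x → Y (inv x)

  WrIntersecting : (Elt → Set) → Set
  WrIntersecting Y =
    ∀ x y → Y x → Y y → Σ Point λ π → ∀ i → act (x ⋆ inv y) π i ≡ π i

module Submission where

-- That S ≀ ℤ_ℓ is a subgroup of G ≀ ℤ_ℓ is checked
-- coordinatewise.  For the intersecting property note that, S being a group,
-- S is intersecting iff every element of S fixes a point of Ω; likewise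
-- x ⋆ inv y lies in S ≀ ℤ_ℓ, so it suffices to show that every element
-- (h ; m) of S ≀ ℤ_ℓ fixes a point π of Ω^{ℤ_ℓ}, i.e. h(i - m) π(i - m) = π(i).
--   * If m = 0 this decouples: take π(i) a fixed point of h(i).
--   * If m ≠ 0 then, ℓ being prime, i ↦ i - m is a single cycle of length ℓ
--     through 0, m, 2m, ….  Let w = h((ℓ-1)m) ⋯ h(m) h(0) ∈ S, the product
--     around the cycle, and ω a fixed point of w.  Transporting ω along the
--     cycle, π(km) = h((k-1)m) ⋯ h(0) ω, solves the equations, the last one
--     closing up because w ω = ω.

open import Defs
open import Data.Nat using (ℕ; NonZero; ≢-nonZero; zero; suc; _+_; _*_; _∸_; _%_; _<_; _≤_; _≟_)
open import Data.Nat.Properties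
  using (+-comm; +-identityʳ; +-assoc; *-comm; *-assoc; *-identityʳ; m∸n+n≡m; <⇒≤; m≤n⇒m<n∨m≡n)
open import Data.Nat.DivMod
  using (_mod_; %-distribˡ-+; %-distribˡ-*; m%n%n≡m%n; [m+n]%n≡m%n; [m+kn]%n≡m%n; m<n⇒m%n≡m; n%n≡0; m%n<n)
open import Data.Nat.Primality using (Prime)
open import Data.Nat.Coprimality using (prime⇒coprime; coprime-Bézout)
open import Data.Nat.GCD using (module Bézout)
open import Data.Nat.Tactic.RingSolver using (solve-∀)
open import Data.Fin using (Fin; toℕ)
open import Data.Fin.Properties using (toℕ-fromℕ<; toℕ<n; toℕ-injective)
open import Data.Fin.Permutation using (Permutation′; _⟨$⟩ʳ_; id)
open import Data.Product using (Σ; _×_; _,_; proj₁; proj₂)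
open import Data.Sum using (inj₁; inj₂)
open import Relation.Binary.PropositionalEquality using (_≡_; refl; sym; trans; cong; subst; module ≡-Reasoning)
open import Relation.Nullary using (yes; no)

open ≡-Reasoning

[m%d+n]%d≡[m+n]%d : ∀ m n d .{{_ : NonZero d}} → (m % d + n) % d ≡ (m + n) % d
[m%d+n]%d≡[m+n]%d m n d = begin
  (m % d + n) % d          ≡⟨ %-distribˡ-+ (m % d) n d ⟩
  (m % d % d + n % d) % d  ≡⟨ cong (λ a → (a + n % d) % d) (m%n%n≡m%n m d) ⟩
  (m % d + n % d) % d      ≡⟨ %-distribˡ-+ m n d ⟨
  (m + n) % d              ∎

[m+n%d]%d≡[m+n]%d : ∀ m n d .{{_ : NonZero d}} → (m + n % d) % d ≡ (m + n) % d
[m+n%d]%d≡[m+n]%d m n d = begin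
  (m + n % d) % d  ≡⟨ cong (_% d) (+-comm m (n % d)) ⟩
  (n % d + m) % d  ≡⟨ [m%d+n]%d≡[m+n]%d n m d ⟩
  (n + m) % d      ≡⟨ cong (_% d) (+-comm n m) ⟩
  (m + n) % d      ∎

[m%d*n]%d≡[m*n]%d : ∀ m n d .{{_ : NonZero d}} → (m % d * n) % d ≡ (m * n) % d
[m%d*n]%d≡[m*n]%d m n d = begin
  (m % d * n) % d            ≡⟨ %-distribˡ-* (m % d) n d ⟩
  (m % d % d * (n % d)) % d  ≡⟨ cong (λ a → (a * (n % d)) % d) (m%n%n≡m%n m d) ⟩
  (m % d * (n % d)) % d      ≡⟨ %-distribˡ-* m n d ⟨
  (m * n) % d                ∎

[m*n%d]%d≡[m*n]%d : ∀ m n d .{{_ : NonZero d}} → (m * (n % d)) % d ≡ (m * n) % d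
[m*n%d]%d≡[m*n]%d m n d = begin
  (m * (n % d)) % d  ≡⟨ cong (_% d) (*-comm m (n % d)) ⟩
  (n % d * m) % d    ≡⟨ [m%d*n]%d≡[m*n]%d n m d ⟩
  (n * m) % d        ≡⟨ cong (_% d) (*-comm n m) ⟩
  (m * n) % d        ∎

-- Modulo a prime p every nonzero s < p has a multiplicative inverse u.
-- Bézout gives 1 + x p = y s (take u = y) or 1 + y s = x p, i.e. y s ≡ -1,
-- and then u = y (p - 1) works since (-1)(-1) = 1.
modular-inverse : ∀ {p} .{{_ : NonZero p}} → Prime p →
                  ∀ s .{{_ : NonZero s}} → s < p → Σ ℕ λ u → (u * s) % p ≡ 1 % p
modular-inverse {p@(suc p-1)} p-prime s s<p with coprime-Bézout (prime⇒coprime p-prime s<p)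
... | Bézout.-+ x y 1+xp≡ys = y , (begin
  (y * s) % p      ≡⟨ cong (_% p) 1+xp≡ys ⟨
  (1 + x * p) % p  ≡⟨ [m+kn]%n≡m%n 1 x p ⟩
  1 % p            ∎)
... | Bézout.+- x y 1+ys≡xp = y * p-1 , (begin
  (y * p-1 * s) % p                ≡⟨ [m+kn]%n≡m%n (y * p-1 * s) 1 p ⟨
  (y * p-1 * s + 1 * suc p-1) % p  ≡⟨ cong (_% p) (expand y p-1 s) ⟩
  ((1 + y * s) * p-1 + 1) % p      ≡⟨ cong (λ a → (a * p-1 + 1) % p) 1+ys≡xp ⟩
  (x * suc p-1 * p-1 + 1) % p      ≡⟨ cong (_% p) (reorder x p-1) ⟩
  (1 + x * p-1 * p) % p            ≡⟨ [m+kn]%n≡m%n 1 (x * p-1) p ⟩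
  1 % p                            ∎)
  where
  expand : ∀ a q b → a * q * b + 1 * suc q ≡ (1 + a * b) * q + 1
  expand = solve-∀
  reorder : ∀ a q → a * suc q * q + 1 ≡ 1 + a * q * suc q
  reorder = solve-∀

mod-periodic : ∀ {A : Set} (a : ℕ → A) L .{{_ : NonZero L}} → a L ≡ a 0 →
               ∀ k → k ≤ L → a (k % L) ≡ a k
mod-periodic a L aL≡a0 k k≤L with m≤n⇒m<n∨m≡n k≤L
... | inj₁ k<L = cong a (m<n⇒m%n≡m k<L)
... | inj₂ refl = trans (cong a (n%n≡0 L)) (sym aL≡a0)

-- pre : I → I is a cyclic order of length L: each i has a position
-- index i < L, at k is the element in position k, and pre i sits one
-- position before i (cyclically).
record CyclicOrder (I : Set) (L : ℕ) .{{_ : NonZero L}} (pre : I → I) : Set where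
  field
    index     : I → ℕ
    at        : ℕ → I
    index<L   : ∀ i → index i < L
    at-index  : ∀ i → at (index i) ≡ i
    index-pre : ∀ i → suc (index (pre i)) % L ≡ index i

HasFixedPoint : ∀ {n} → Permutation′ n → Set
HasFixedPoint {n} x = Σ (Fin n) λ ω → x ⟨$⟩ʳ ω ≡ ω

intersecting⇒fixed-point : ∀ {n} {S : Permutation′ n → Set} → IsPermGroup S →
                           Intersecting S → ∀ x → S x → HasFixedPoint x
intersecting⇒fixed-point S-group S-intersecting x x∈S =
  S-intersecting x id x∈S (IsPermGroup.id∈ S-group)

module ClosingCycles {n} {S : Permutation′ n → Set} (S-group : IsPermGroup S)
                     (S-fixed : ∀ x → S x → HasFixedPoint x) where
  open IsPermGroup S-group

  -- Along a cyclic order, the "twisted" equations h(pre i) π(pre i) = π(i)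
  -- with all h(i) ∈ S have a solution: start at a fixed point ω of the
  -- product of h around the whole cycle and transport it along the cycle.
  cycle-solution : ∀ {I L pre} .{{_ : NonZero L}} → CyclicOrder I L pre →
                   (h : I → Permutation′ n) → (∀ i → S (h i)) →
                   Σ (I → Fin n) λ π → ∀ i → h (pre i) ⟨$⟩ʳ π (pre i) ≡ π i
  cycle-solution {I} {L} {pre} C h h∈S = π , solves
    where
    open CyclicOrder C

    walk : ℕ → Permutation′ n
    walk zero    = id
    walk (suc k) = h (at k) · walk k

    walk∈S : ∀ k → S (walk k)
    walk∈S zero    = id∈
    walk∈S (suc k) = ·-closed (h∈S (at k)) (walk∈S k)

    ω : Fin n
    ω = proj₁ (S-fixed (walk L) (walk∈S L))

    orbit : ℕ → Fin n
    orbit k = walk k ⟨$⟩ʳ ω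

    π : I → Fin n
    π i = orbit (index i)

    solves : ∀ i → h (pre i) ⟨$⟩ʳ π (pre i) ≡ π i
    solves i = begin
      h (pre i) ⟨$⟩ʳ orbit k       ≡⟨ cong (λ j → h j ⟨$⟩ʳ orbit k) (at-index (pre i)) ⟨
      orbit (suc k)               ≡⟨ mod-periodic orbit L (proj₂ (S-fixed (walk L) (walk∈S L))) (suc k) (index<L (pre i)) ⟨
      orbit (suc k % L)           ≡⟨ cong orbit (index-pre i) ⟩
      π i                         ∎
      where
      k : ℕ
      k = index (pre i)

module WreathFacts (n ℓ : ℕ) .{{_ : NonZero ℓ}} where
  open Wreath n ℓ

  toℕ-mod : ∀ a → toℕ (a mod ℓ) ≡ a % ℓ
  toℕ-mod a = toℕ-fromℕ< (m%n<n a ℓ)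

  ⊖-cancel : ∀ i m → (toℕ (i ⊖ m) + toℕ m) % ℓ ≡ toℕ i
  ⊖-cancel i m = begin
    (toℕ (i ⊖ m) + s) % ℓ            ≡⟨ cong (λ a → (a + s) % ℓ) (toℕ-mod (toℕ i + (ℓ ∸ s))) ⟩
    ((toℕ i + (ℓ ∸ s)) % ℓ + s) % ℓ  ≡⟨ [m%d+n]%d≡[m+n]%d (toℕ i + (ℓ ∸ s)) s ℓ ⟩
    (toℕ i + (ℓ ∸ s) + s) % ℓ        ≡⟨ cong (_% ℓ) (+-assoc (toℕ i) (ℓ ∸ s) s) ⟩
    (toℕ i + (ℓ ∸ s + s)) % ℓ        ≡⟨ cong (λ a → (toℕ i + a) % ℓ) (m∸n+n≡m (<⇒≤ (toℕ<n m))) ⟩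
    (toℕ i + ℓ) % ℓ                  ≡⟨ [m+n]%n≡m%n (toℕ i) ℓ ⟩
    toℕ i % ℓ                        ≡⟨ m<n⇒m%n≡m (toℕ<n i) ⟩
    toℕ i                            ∎
    where
    s : ℕ
    s = toℕ m

  ⊖-zero : ∀ i m → toℕ m ≡ 0 → i ⊖ m ≡ i
  ⊖-zero i m m≡0 = toℕ-injective (begin
    toℕ (i ⊖ m)                ≡⟨ m<n⇒m%n≡m (toℕ<n (i ⊖ m)) ⟨
    toℕ (i ⊖ m) % ℓ            ≡⟨ cong (_% ℓ) (+-identityʳ (toℕ (i ⊖ m))) ⟨
    (toℕ (i ⊖ m) + 0) % ℓ      ≡⟨ cong (λ a → (toℕ (i ⊖ m) + a) % ℓ) m≡0 ⟨
    (toℕ (i ⊖ m) + toℕ m) % ℓ  ≡⟨ ⊖-cancel i m ⟩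
    toℕ i                      ∎)

  -- For ℓ prime and m ≠ 0, i ↦ i - m is a single cycle of length ℓ:
  -- j sits in position j · m⁻¹, and position k holds k · m.
  shift-cycle : Prime ℓ → ∀ m .{{_ : NonZero (toℕ m)}} → CyclicOrder (Fin ℓ) ℓ (_⊖ m)
  shift-cycle ℓ-prime m = record
    { index     = index
    ; at        = at
    ; index<L   = λ j → m%n<n (toℕ j * u) ℓ
    ; at-index  = λ j → toℕ-injective (trans (toℕ-mod (index j * s)) (index*s≡ j))
    ; index-pre = index-pre
    }
    where
    s : ℕ
    s = toℕ m

    inverse : Σ ℕ λ u → (u * s) % ℓ ≡ 1 % ℓ
    inverse = modular-inverse ℓ-prime s (toℕ<n m)

    u : ℕ
    u = proj₁ inverse

    u*s≡1 : (u * s) % ℓ ≡ 1 % ℓ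
    u*s≡1 = proj₂ inverse

    index : Fin ℓ → ℕ
    index j = (toℕ j * u) % ℓ

    at : ℕ → Fin ℓ
    at k = (k * s) mod ℓ

    index*s≡ : ∀ j → (index j * s) % ℓ ≡ toℕ j
    index*s≡ j = begin
      ((toℕ j * u) % ℓ * s) % ℓ  ≡⟨ [m%d*n]%d≡[m*n]%d (toℕ j * u) s ℓ ⟩
      (toℕ j * u * s) % ℓ        ≡⟨ cong (_% ℓ) (*-assoc (toℕ j) u s) ⟩
      (toℕ j * (u * s)) % ℓ      ≡⟨ [m*n%d]%d≡[m*n]%d (toℕ j) (u * s) ℓ ⟨
      (toℕ j * (u * s % ℓ)) % ℓ  ≡⟨ cong (λ a → (toℕ j * a) % ℓ) u*s≡1 ⟩
      (toℕ j * (1 % ℓ)) % ℓ      ≡⟨ [m*n%d]%d≡[m*n]%d (toℕ j) 1 ℓ ⟩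
      (toℕ j * 1) % ℓ            ≡⟨ cong (_% ℓ) (*-identityʳ (toℕ j)) ⟩
      toℕ j % ℓ                  ≡⟨ m<n⇒m%n≡m (toℕ<n j) ⟩
      toℕ j                      ∎

    regroup : ∀ a b c → a * b + c * a ≡ (c + b) * a
    regroup = solve-∀

    -- one step forward adds u·s ≡ 1 to the position
    index-pre : ∀ i → suc (index (i ⊖ m)) % ℓ ≡ index i
    index-pre i = begin
      (1 + index d) % ℓ              ≡⟨ [m%d+n]%d≡[m+n]%d 1 (index d) ℓ ⟨
      (1 % ℓ + index d) % ℓ          ≡⟨ cong (λ a → (a + index d) % ℓ) u*s≡1 ⟨
      ((u * s) % ℓ + index d) % ℓ    ≡⟨ [m%d+n]%d≡[m+n]%d (u * s) (index d) ℓ ⟩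
      (u * s + index d) % ℓ          ≡⟨ [m+n%d]%d≡[m+n]%d (u * s) (toℕ d * u) ℓ ⟩
      (u * s + toℕ d * u) % ℓ        ≡⟨ cong (_% ℓ) (regroup u s (toℕ d)) ⟩
      ((toℕ d + s) * u) % ℓ          ≡⟨ [m%d*n]%d≡[m*n]%d (toℕ d + s) u ℓ ⟨
      ((toℕ d + s) % ℓ * u) % ℓ      ≡⟨ cong (λ a → (a * u) % ℓ) (⊖-cancel i m) ⟩
      index i                        ∎
      where
      d : Fin ℓ
      d = i ⊖ m

  ≀ℤ-subgroup : ∀ {S G} → IsSubgroup S G → IsWrSubgroup (S ≀ℤ) (G ≀ℤ)
  ≀ℤ-subgroup S≤G = record
    { ⊆X         = λ x∈ j → ⊆G (x∈ j)
    ; one∈       = λ _ → id∈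
    ; ⋆-closed   = λ x∈ y∈ j → ·-closed (x∈ _) (y∈ j)
    ; inv-closed = λ x∈ j → ⁻¹-closed (x∈ _)
    }
    where
    open IsSubgroup S≤G
    open IsPermGroup isGroup

  -- For m = 0 the coordinates
  -- decouple; otherwise i ↦ i - m is one cycle and we close it.
  ≀ℤ-fixed-point : ∀ {S} → IsPermGroup S → (∀ x → S x → HasFixedPoint x) → Prime ℓ →
                   ∀ x → (S ≀ℤ) x → Σ Point λ π → ∀ i → act x π i ≡ π i
  ≀ℤ-fixed-point S-group S-fixed ℓ-prime (h ︔ m) h∈S with toℕ m ≟ 0
  ... | yes m≡0 = π , λ i →
          subst (λ d → h d ⟨$⟩ʳ π d ≡ π i) (sym (⊖-zero i m m≡0)) (proj₂ (S-fixed (h i) (h∈S i)))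
    where
    π : Point
    π i = proj₁ (S-fixed (h i) (h∈S i))
  ... | no m≢0 = cycle-solution (shift-cycle ℓ-prime m {{≢-nonZero m≢0}}) h h∈S
    where open ClosingCycles S-group S-fixed

lemma3p1 : (n ℓ : ℕ) .{{_ : NonZero ℓ}} → Prime ℓ →
    (G S : Permutation′ n → Set) → IsPermGroup G →
    IsSubgroup S G → Intersecting S →
    Wreath.IsWrSubgroup n ℓ (Wreath._≀ℤ n ℓ S) (Wreath._≀ℤ n ℓ G)
      × Wreath.WrIntersecting n ℓ (Wreath._≀ℤ n ℓ S)
lemma3p1 n ℓ ℓ-prime G S _ S≤G S-intersecting = S≀ℤ≤G≀ℤ , S≀ℤ-intersecting
  where
  open Wreath n ℓ
  open WreathFacts n ℓ
  open IsSubgroup S≤G using (isGroup)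

  S≀ℤ≤G≀ℤ : IsWrSubgroup (S ≀ℤ) (G ≀ℤ)
  S≀ℤ≤G≀ℤ = ≀ℤ-subgroup S≤G

  open IsWrSubgroup S≀ℤ≤G≀ℤ using (⋆-closed; inv-closed)

  S≀ℤ-intersecting : WrIntersecting (S ≀ℤ)
  S≀ℤ-intersecting x y x∈ y∈ =
    ≀ℤ-fixed-point isGroup (intersecting⇒fixed-point isGroup S-intersecting) ℓ-prime
      (x ⋆ inv y) (⋆-closed {x} {inv y} x∈ (inv-closed {y} y∈))
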